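{- Let $S$ be a numerical semigroup with multiplicity $m$, embedding dimension $\nu$ and conductor $f+1=qm-\rho$ for some $q\in\mathbb N$ and $0\le\rho\le m-1$. Let $\mathrm{Ap}(S,m)=\{w_0=0<w_1<\dots<w_{m-1}\}$. Then $S$ satisfies Wilf's Conjecture (i.e. $f+1\le\nu n$) if and only if $$\sum_{j=1}^{m-1}\left(\left\lfloor\frac{w_j+\rho}{m}\right\rfloor-\left\lfloor\frac{w_{j-1}+\rho}{m}\right\rfloor\right)(j\nu-m)+\rho\ge0.$$
   Context: A numerical semigroup is a submonoid of $(\mathbb N,+)$ with finite complement. $f$ is its Frobenius number (largest integer not in $S$), $m$ its smallest nonzero element, $\nu$ its minimal number of generators, and $n=|\{s\in S: s<f\}|$. $\mathrm{Ap}(S,m)=\{s\in S: s-m\notin S\}$, an $m$-element set listed increasingly. -}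

module Defs where

open import Data.Bool using (Bool; true; false; T)
open import Data.Nat using (ℕ; zero; suc; _+_; _*_; _∸_; _≤_; _<_; NonZero)
open import Data.Nat.DivMod using (_/_)
open import Data.Integer as ℤ using (ℤ; +_)
open import Data.List using (List; []; _∷_; upTo; filterᵇ; length; map; foldr)
open import Data.Vec using (Vec; lookup; zipWith)
import Data.Vec as Vec
open import Data.Fin using (Fin)
open import Data.Product using (Σ; ∃; _×_)
open import Relation.Nullary using (¬_)
open import Relation.Binary.PropositionalEquality using (_≡_)

record NumericalSemigroup : Set where
  field
    mem      : ℕ → Bool
    zero∈    : T (mem 0)
    closed   : ∀ a b → T (mem a) → T (mem b) → T (mem (a + b))
    cofinite : ∃ λ N → ∀ x → N ≤ x → T (mem x)

module _ (S : NumericalSemigroup) where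
  open NumericalSemigroup S

  _∈S : ℕ → Set
  x ∈S = T (mem x)

  IsMultiplicity : ℕ → Set
  IsMultiplicity m = (1 ≤ m) × (m ∈S) × (∀ s → 1 ≤ s → s ∈S → m ≤ s)

  IsConductor : ℕ → Set
  IsConductor c = (∀ x → c ≤ x → x ∈S)
                × (∀ d → (∀ x → d ≤ x → x ∈S) → c ≤ d)

  Generates : {k : ℕ} → Vec ℕ k → Set
  Generates {k} gs = (∀ i → lookup gs i ∈S)
                   × (∀ s → s ∈S → ∃ λ (cs : Vec ℕ k) →
                        Vec.foldr _ _+_ 0 (zipWith _*_ cs gs) ≡ s)

  IsEmbeddingDimension : ℕ → Set
  IsEmbeddingDimension ν = (Σ (Vec ℕ ν) Generates)
                         × (∀ k (gs : Vec ℕ k) → Generates gs → ν ≤ k)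

  InApery : ℕ → ℕ → Set
  InApery m s = (s ∈S) × (m ≤ s → ¬ ((s ∸ m) ∈S))

  -- w 0 < w 1 < ... < w (m-1) is the increasing listing of Ap(S,m)
  -- (values of w at indices ≥ m are irrelevant)
  IsAperyListing : ℕ → (ℕ → ℕ) → Set
  IsAperyListing m w = (∀ i j → j < m → i < j → w i < w j)
                     × (∀ s → InApery m s → ∃ λ j → j < m × w j ≡ s)
                     × (∀ j → j < m → InApery m (w j))

  -- n = #{ s ∈ S : s < f }, with f = c - 1 the Frobenius number
  -- (for c = 0, i.e. f = -1, the count is 0)
  smallElements : ℕ → ℕ
  smallElements c = length (filterᵇ mem (upTo (c ∸ 1)))

sumℤ : List ℤ → ℤ
sumℤ = foldr ℤ._+_ (+ 0)

wilfSum : (m ν ρ : ℕ) .{{_ : NonZero m}} → (ℕ → ℕ) → ℤ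
wilfSum m ν ρ w =
  sumℤ (map (λ i → let j = suc i in
                ((+ ((w j + ρ) / m)) ℤ.- (+ ((w i + ρ) / m)))
                  ℤ.* ((+ (j * ν)) ℤ.- (+ m)))
            (upTo (m ∸ 1)))
  ℤ.+ (+ ρ)

-- Every s ∈ S is w_j + k m for a unique j, so the elements of S below c = q m − ρ
-- are counted residue class by residue class: class j contributes q − a_j elements,
-- where a_j = ⌊(w_j + ρ)/m⌋.  Hence n = Σ_{j<m} (q − a_j), with a_0 = 0 and
-- a_{m−1} = q because the largest Apéry element is f + m.  Abel summation turns the
-- Wilf sum into ν (Σ_j j (a_j − a_{j−1})) − m (a_{m−1} − a_0) + ρ = ν n − c,
-- so the two conditions are the same inequality.
module Submission where

open import Defs
open import Data.Bool using (Bool; true; false; T)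
open import Data.Empty using (⊥-elim)
open import Data.Integer as ℤ using (ℤ; +_; +≤+) renaming (_≤_ to _≤ℤ_)
import Data.Integer.Properties as ℤP
import Data.Integer.Tactic.RingSolver as ℤ-Solver
open import Data.List using ([]; _∷_; [_]; _++_; map; upTo; filterᵇ; length)
open import Data.List.Properties using (upTo-∷ʳ; map-++; length-++; filter-++)
open import Data.Nat
  using (ℕ; zero; suc; pred; _+_; _*_; _∸_; _≤_; _<_; _≤?_; NonZero; z≤n; z<s; >-nonZero⁻¹)
open import Data.Nat.Properties
open import Data.Nat.DivMod using (_/_; _%_; m≡m%n+[m/n]*n; m%n<n; [m+kn]%n≡m%n; m*n%n≡0; m<n⇒m%n≡m; m*n/n≡m; /-monoˡ-≤; m<n*o⇒m/o<n; m<n⇒m/n≡0)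
open import Data.Nat.Divisibility using (_∣_; _∣?_; divides)
open import Data.Nat.Induction using (<-wellFounded)
open import Data.Nat.Tactic.RingSolver using (solve; solve-∀)
open import Data.Product using (∃-syntax; _×_; _,_; proj₁; proj₂)
open import Data.Sum using (inj₁; inj₂)
open import Function using (_∘_)
open import Function.Bundles using (_⇔_; mk⇔)
open import Induction.WellFounded using (Acc; acc)
open import Relation.Binary.Definitions using (tri<; tri≈; tri>)
open import Relation.Binary.PropositionalEquality
  using (_≡_; _≢_; refl; sym; trans; cong; cong₂; subst; subst₂; module ≡-Reasoning)
open import Relation.Nullary using (¬_; Dec; yes; no)
open import Relation.Nullary.Decidable using (map′; _×-dec_; T?)

open ≡-Reasoning

∑< : (ℕ → ℕ) → ℕ → ℕ
∑< f zero    = 0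
∑< f (suc L) = ∑< f L + f L

∑<-cong : ∀ {f g} L → (∀ j → j < L → f j ≡ g j) → ∑< f L ≡ ∑< g L
∑<-cong zero    _   = refl
∑<-cong (suc L) f≗g = cong₂ _+_ (∑<-cong L (λ j j<L → f≗g j (m<n⇒m<1+n j<L))) (f≗g L (n<1+n L))

∑<-zero : ∀ {f} L → (∀ j → j < L → f j ≡ 0) → ∑< f L ≡ 0
∑<-zero zero    _   = refl
∑<-zero (suc L) f≡0 = cong₂ _+_ (∑<-zero L (λ j j<L → f≡0 j (m<n⇒m<1+n j<L))) (f≡0 L (n<1+n L))

∑<-single : ∀ {f i} L → i < L → (∀ j → j < L → j ≢ i → f j ≡ 0) → ∑< f L ≡ f i
∑<-single {f} {i} (suc L) i<1+L others with m<1+n⇒m<n∨m≡n i<1+L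
... | inj₁ i<L = begin
  ∑< f L + f L ≡⟨ cong₂ _+_ (∑<-single L i<L (λ j j<L → others j (m<n⇒m<1+n j<L)))
                            (others L (n<1+n L) (λ L≡i → <⇒≢ i<L (sym L≡i))) ⟩
  f i + 0      ≡⟨ +-identityʳ (f i) ⟩
  f i          ∎
... | inj₂ refl = cong (_+ f i) (∑<-zero L (λ j j<L → others j (m<n⇒m<1+n j<L) (<⇒≢ j<L)))

∑<-+ : ∀ f g L → ∑< (λ j → f j + g j) L ≡ ∑< f L + ∑< g L
∑<-+ f g zero    = refl
∑<-+ f g (suc L) = trans (cong (_+ (f L + g L)) (∑<-+ f g L)) (+-interchange (∑< f L) (∑< g L) (f L) (g L))
  where
  +-interchange : ∀ a b c d → a + b + (c + d) ≡ a + c + (b + d)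
  +-interchange = solve-∀

Bool→ℕ : Bool → ℕ
Bool→ℕ true  = 1
Bool→ℕ false = 0

Bool→ℕ-T : ∀ {b} → T b → Bool→ℕ b ≡ 1
Bool→ℕ-T {true} _ = refl

Bool→ℕ-¬T : ∀ {b} → ¬ T b → Bool→ℕ b ≡ 0
Bool→ℕ-¬T {false} _  = refl
Bool→ℕ-¬T {true}  ¬T = ⊥-elim (¬T _)

countBelow : (ℕ → Bool) → ℕ → ℕ
countBelow p N = length (filterᵇ p (upTo N))

countBelow-suc : ∀ p N → countBelow p (suc N) ≡ countBelow p N + Bool→ℕ (p N)
countBelow-suc p N = begin
  length (filterᵇ p (upTo (suc N)))              ≡⟨ cong (length ∘ filterᵇ p) (upTo-∷ʳ N) ⟨
  length (filterᵇ p (upTo N ++ [ N ]))           ≡⟨ cong length (filter-++ (T? ∘ p) (upTo N) [ N ]) ⟩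
  length (filterᵇ p (upTo N) ++ filterᵇ p [ N ]) ≡⟨ length-++ (filterᵇ p (upTo N)) ⟩
  countBelow p N + length (filterᵇ p [ N ])      ≡⟨ cong (_+_ (countBelow p N)) length-filterᵇ-[N] ⟩
  countBelow p N + Bool→ℕ (p N)                  ∎
  where
  length-filterᵇ-[N] : length (filterᵇ p [ N ]) ≡ Bool→ℕ (p N)
  length-filterᵇ-[N] with p N
  ... | true  = refl
  ... | false = refl

m+n*o+o≡m+[1+n]*o : ∀ m n o → m + n * o + o ≡ m + suc n * o
m+n*o+o≡m+[1+n]*o = solve-∀

module Progression (M : ℕ) .{{_ : NonZero M}} where

  InProgression : ℕ → ℕ → Set
  InProgression x N = ∃[ k ] N ≡ x + k * M

  inProgression? : ∀ x N → Dec (InProgression x N)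
  inProgression? x N = map′ fromDivides toDivides (x ≤? N ×-dec M ∣? (N ∸ x))
    where
    fromDivides : x ≤ N × M ∣ N ∸ x → InProgression x N
    fromDivides (x≤N , divides k N∸x≡kM) = k , trans (sym (m+[n∸m]≡n x≤N)) (cong (_+_ x) N∸x≡kM)
    toDivides : InProgression x N → x ≤ N × M ∣ N ∸ x
    toDivides (k , N≡x+kM) rewrite N≡x+kM = m≤m+n x (k * M) , divides k (m+n∸m≡n x (k * M))

  hit : ℕ → ℕ → ℕ
  hit x N with inProgression? x N
  ... | yes _ = 1
  ... | no _  = 0

  hit-∈ : ∀ x k → hit x (x + k * M) ≡ 1
  hit-∈ x k with inProgression? x (x + k * M)
  ... | yes _ = refl
  ... | no ∉  = ⊥-elim (∉ (k , refl))

  hit-∉ : ∀ {x N} → ¬ InProgression x N → hit x N ≡ 0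
  hit-∉ {x} {N} ∉ with inProgression? x N
  ... | yes ∈ = ⊥-elim (∉ ∈)
  ... | no _  = refl

  ∉-offset : ∀ x k r → suc r < M → ¬ InProgression x (suc (x + k * M + r))
  ∉-offset x k r 1+r<M (l , e) = 1+n≢0 (begin
    suc r                 ≡⟨ m<n⇒m%n≡m 1+r<M ⟨
    suc r % M             ≡⟨ [m+kn]%n≡m%n (suc r) k M ⟨
    (suc r + k * M) % M   ≡⟨ cong (_% M) (+-cancelˡ-≡ x _ _ (trans (reassoc x k r M) e)) ⟩
    l * M % M             ≡⟨ m*n%n≡0 l M ⟩
    0                     ∎)
    where
    reassoc : ∀ x k r M → x + (suc r + k * M) ≡ suc (x + k * M + r)
    reassoc = solve-∀

  pred<M : pred M < M
  pred<M = ≤-reflexive (suc-pred M)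

  -- countAP x N = #{k | x + k M < N}
  countAP : ℕ → ℕ → ℕ
  countAP x = ∑< (hit x)

  countAP-≤ : ∀ x N → N ≤ x → countAP x N ≡ 0
  countAP-≤ x N N≤x = ∑<-zero N λ j j<N → hit-∉ λ (k , j≡x+kM) →
    <⇒≱ (<-≤-trans j<N N≤x) (subst (x ≤_) (sym j≡x+kM) (m≤m+n x (k * M)))

  mutual
    countAP-at : ∀ x k → countAP x (x + k * M) ≡ k
    countAP-at x zero    = trans (cong (countAP x) (+-identityʳ x)) (countAP-≤ x x ≤-refl)
    countAP-at x (suc k) = begin
      countAP x (x + suc k * M)              ≡⟨ cong (countAP x) (m+n*o+o≡m+[1+n]*o x k M) ⟨
      countAP x (x + k * M + M)              ≡⟨ cong (λ t → countAP x (x + k * M + t)) (suc-pred M) ⟨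
      countAP x (x + k * M + suc (pred M))   ≡⟨ cong (countAP x) (+-suc (x + k * M) (pred M)) ⟩
      countAP x (suc (x + k * M + pred M))   ≡⟨ countAP-within x k (pred M) pred<M ⟩
      suc k                                  ∎

    countAP-within : ∀ x k r → r < M → countAP x (suc (x + k * M + r)) ≡ suc k
    countAP-within x k zero _ = begin
      countAP x (x + k * M + 0) + hit x (x + k * M + 0) ≡⟨ cong (λ N → countAP x N + hit x N) (+-identityʳ (x + k * M)) ⟩
      countAP x (x + k * M) + hit x (x + k * M)         ≡⟨ cong₂ _+_ (countAP-at x k) (hit-∈ x k) ⟩
      k + 1                                             ≡⟨ +-comm k 1 ⟩
      suc k                                             ∎
    countAP-within x k (suc r) 1+r<M = begin
      countAP x (x + k * M + suc r) + hit x (x + k * M + suc r)     ≡⟨ cong (λ N → countAP x N + hit x N) (+-suc (x + k * M) r) ⟩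
      countAP x (suc (x + k * M + r)) + hit x (suc (x + k * M + r)) ≡⟨ cong₂ _+_ (countAP-within x k r (<⇒≤ 1+r<M)) (hit-∉ (∉-offset x k r 1+r<M)) ⟩
      suc k + 0                                                     ≡⟨ +-identityʳ (suc k) ⟩
      suc k                                                         ∎

  conductor-offset : ∀ x ρ a b c k d → x + ρ ≡ b + a * M → suc (b + d) ≡ M →
                     c + ρ ≡ (suc a + k) * M → c ≡ suc (x + k * M + d)
  conductor-offset x ρ a b c k d x+ρ≡b+aM b+d+1≡M c+ρ≡[1+a+k]M =
    +-cancelʳ-≡ ρ _ _ (begin
      c + ρ                        ≡⟨ c+ρ≡[1+a+k]M ⟩
      (suc a + k) * M              ≡⟨ cong (λ t → t + (a + k) * M) b+d+1≡M ⟨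
      suc (b + d) + (a + k) * M    ≡⟨ regroup b a d k M ⟩
      b + a * M + (suc d + k * M)  ≡⟨ cong (_+ (suc d + k * M)) x+ρ≡b+aM ⟨
      x + ρ + (suc d + k * M)      ≡⟨ regroup′ x ρ d k M ⟩
      suc (x + k * M + d) + ρ      ∎)
    where
    regroup : ∀ b a d k M → suc (b + d) + (a + k) * M ≡ b + a * M + (suc d + k * M)
    regroup = solve-∀
    regroup′ : ∀ x ρ d k M → x + ρ + (suc d + k * M) ≡ suc (x + k * M + d) + ρ
    regroup′ = solve-∀

  countAP-closedForm : ∀ x ρ a b c q → x + ρ ≡ b + a * M → b < M → c + ρ ≡ q * M →
                       countAP x c ≡ q ∸ a
  countAP-closedForm x ρ a b c q x+ρ≡b+aM b<M c+ρ≡qM with q ≤? a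
  ... | yes q≤a = trans (countAP-≤ x c c≤x) (sym (m≤n⇒m∸n≡0 q≤a))
    where
    c≤x : c ≤ x
    c≤x = +-cancelʳ-≤ ρ c x (subst₂ _≤_ (sym c+ρ≡qM) (sym x+ρ≡b+aM)
            (≤-trans (*-monoˡ-≤ M q≤a) (m≤n+m (a * M) b)))
  ... | no q≰a = begin
    countAP x c                                          ≡⟨ cong (countAP x) c≡ ⟩
    countAP x (suc (x + (q ∸ suc a) * M + (pred M ∸ b))) ≡⟨ countAP-within x (q ∸ suc a) (pred M ∸ b) d<M ⟩
    suc (q ∸ suc a)                                      ≡⟨ +-∸-assoc 1 a<q ⟨
    q ∸ a                                                ∎
    where
    a<q : a < q
    a<q = ≰⇒> q≰a
    d<M : pred M ∸ b < M
    d<M = ≤-<-trans (m∸n≤m (pred M) b) pred<M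
    c≡ : c ≡ suc (x + (q ∸ suc a) * M + (pred M ∸ b))
    c≡ = conductor-offset x ρ a b c (q ∸ suc a) (pred M ∸ b) x+ρ≡b+aM
           (trans (cong suc (m+[n∸m]≡n (<⇒≤pred b<M))) (suc-pred M))
           (trans c+ρ≡qM (cong (_* M) (sym (m+[n∸m]≡n a<q))))

sumℤ-++ : ∀ xs ys → sumℤ (xs ++ ys) ≡ sumℤ xs ℤ.+ sumℤ ys
sumℤ-++ []       ys = sym (ℤP.+-identityˡ (sumℤ ys))
sumℤ-++ (x ∷ xs) ys = trans (cong (ℤ._+_ x) (sumℤ-++ xs ys)) (sym (ℤP.+-assoc x (sumℤ xs) (sumℤ ys)))

∑ℤ< : (ℕ → ℤ) → ℕ → ℤ
∑ℤ< a L = sumℤ (map a (upTo L))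

∑ℤ<-suc : ∀ a L → ∑ℤ< a (suc L) ≡ ∑ℤ< a L ℤ.+ a L
∑ℤ<-suc a L = begin
  sumℤ (map a (upTo (suc L)))       ≡⟨ cong (sumℤ ∘ map a) (upTo-∷ʳ L) ⟨
  sumℤ (map a (upTo L ++ [ L ]))    ≡⟨ cong sumℤ (map-++ a (upTo L) [ L ]) ⟩
  sumℤ (map a (upTo L) ++ [ a L ])  ≡⟨ sumℤ-++ (map a (upTo L)) [ a L ] ⟩
  ∑ℤ< a L ℤ.+ (a L ℤ.+ + 0)         ≡⟨ cong (ℤ._+_ (∑ℤ< a L)) (ℤP.+-identityʳ (a L)) ⟩
  ∑ℤ< a L ℤ.+ a L                   ∎

pos-[1+m]*n : ∀ m n → + (suc m * n) ≡ (ℤ.1ℤ ℤ.+ + m) ℤ.* + n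
pos-[1+m]*n m n = trans (ℤP.pos-* (suc m) n) (cong (ℤ._* + n) (ℤP.pos-+ 1 m))

abelSummation : ∀ (ν m : ℕ) (a : ℕ → ℤ) L →
  ∑ℤ< (λ i → (a (suc i) ℤ.- a i) ℤ.* (+ (suc i * ν) ℤ.- + m)) L
    ≡ + ν ℤ.* (+ L ℤ.* a L ℤ.- ∑ℤ< a L) ℤ.- + m ℤ.* (a L ℤ.- a 0)
abelSummation ν m a zero = sym (vanish (+ ν) (+ m) (a 0))
  where
  vanish : ∀ ν m x → ν ℤ.* (+ 0 ℤ.* x ℤ.- + 0) ℤ.- m ℤ.* (x ℤ.- x) ≡ + 0
  vanish = ℤ-Solver.solve-∀
abelSummation ν m a (suc L) = begin
  ∑ℤ< F (suc L)
    ≡⟨ ∑ℤ<-suc F L ⟩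
  ∑ℤ< F L ℤ.+ F L
    ≡⟨ cong₂ ℤ._+_ (abelSummation ν m a L) (cong (λ t → (a (suc L) ℤ.- a L) ℤ.* (t ℤ.- + m)) (pos-[1+m]*n L ν)) ⟩
  + ν ℤ.* (+ L ℤ.* a L ℤ.- ∑ℤ< a L) ℤ.- + m ℤ.* (a L ℤ.- a 0)
    ℤ.+ (a (suc L) ℤ.- a L) ℤ.* ((ℤ.1ℤ ℤ.+ + L) ℤ.* + ν ℤ.- + m)
    ≡⟨ step (+ ν) (+ m) (+ L) (a 0) (a L) (a (suc L)) (∑ℤ< a L) ⟩
  + ν ℤ.* ((ℤ.1ℤ ℤ.+ + L) ℤ.* a (suc L) ℤ.- (∑ℤ< a L ℤ.+ a L)) ℤ.- + m ℤ.* (a (suc L) ℤ.- a 0)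
    ≡⟨ cong₂ (λ s t → + ν ℤ.* (s ℤ.* a (suc L) ℤ.- t) ℤ.- + m ℤ.* (a (suc L) ℤ.- a 0))
             (sym (ℤP.pos-+ 1 L)) (sym (∑ℤ<-suc a L)) ⟩
  + ν ℤ.* (+ suc L ℤ.* a (suc L) ℤ.- ∑ℤ< a (suc L)) ℤ.- + m ℤ.* (a (suc L) ℤ.- a 0) ∎
  where
  F : ℕ → ℤ
  F i = (a (suc i) ℤ.- a i) ℤ.* (+ (suc i * ν) ℤ.- + m)
  step : ∀ ν m L x₀ x y A →
    ν ℤ.* (L ℤ.* x ℤ.- A) ℤ.- m ℤ.* (x ℤ.- x₀) ℤ.+ (y ℤ.- x) ℤ.* ((ℤ.1ℤ ℤ.+ L) ℤ.* ν ℤ.- m)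
      ≡ ν ℤ.* ((ℤ.1ℤ ℤ.+ L) ℤ.* y ℤ.- (A ℤ.+ x)) ℤ.- m ℤ.* (y ℤ.- x₀)
  step = ℤ-Solver.solve-∀

+∑<-∸ : ∀ q (a : ℕ → ℕ) L → (∀ j → j < L → a j ≤ q) →
  + ∑< (λ j → q ∸ a j) L ≡ + L ℤ.* + q ℤ.- ∑ℤ< (λ j → + a j) L
+∑<-∸ q a zero    _   = refl
+∑<-∸ q a (suc L) a≤q = begin
  + (∑< (λ j → q ∸ a j) L + (q ∸ a L))
    ≡⟨ ℤP.pos-+ (∑< (λ j → q ∸ a j) L) (q ∸ a L) ⟩
  + ∑< (λ j → q ∸ a j) L ℤ.+ + (q ∸ a L)
    ≡⟨ cong₂ ℤ._+_ (+∑<-∸ q a L (λ j j<L → a≤q j (m<n⇒m<1+n j<L))) +[q∸aL]≡+q-+aL ⟩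
  (+ L ℤ.* + q ℤ.- A) ℤ.+ (+ q ℤ.- + a L)
    ≡⟨ step (+ L) (+ q) A (+ a L) ⟩
  (ℤ.1ℤ ℤ.+ + L) ℤ.* + q ℤ.- (A ℤ.+ + a L)
    ≡⟨ cong₂ (λ s t → s ℤ.* + q ℤ.- t) (sym (ℤP.pos-+ 1 L)) (sym (∑ℤ<-suc (λ j → + a j) L)) ⟩
  + suc L ℤ.* + q ℤ.- ∑ℤ< (λ j → + a j) (suc L) ∎
  where
  A : ℤ
  A = ∑ℤ< (λ j → + a j) L
  +[q∸aL]≡+q-+aL : + (q ∸ a L) ≡ + q ℤ.- + a L
  +[q∸aL]≡+q-+aL = sym (trans (ℤP.[+m]-[+n]≡m⊖n q (a L)) (ℤP.⊖-≥ (a≤q L (n<1+n L))))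
  step : ∀ L q A x → (L ℤ.* q ℤ.- A) ℤ.+ (q ℤ.- x) ≡ (ℤ.1ℤ ℤ.+ L) ℤ.* q ℤ.- (A ℤ.+ x)
  step = ℤ-Solver.solve-∀

≤⇔0≤[+n]-[+m] : ∀ {m n} → m ≤ n ⇔ + 0 ≤ℤ + n ℤ.- + m
≤⇔0≤[+n]-[+m] = mk⇔ (λ m≤n → ℤP.i≤j⇒0≤j-i (+≤+ m≤n)) (λ 0≤n-m → ℤP.drop‿+≤+ (ℤP.0≤i-j⇒j≤i 0≤n-m))

module Apery (S : NumericalSemigroup) where
  open NumericalSemigroup S

  frobenius∉S : ∀ {f} → IsConductor S (suc f) → ¬ T (mem f)
  frobenius∉S {f} (above , least) f∈S = 1+n≰n (least f above-f)
    where
    above-f : ∀ x → f ≤ x → T (mem x)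
    above-f x f≤x with m≤n⇒m<n∨m≡n f≤x
    ... | inj₁ f<x  = above x f<x
    ... | inj₂ refl = f∈S

  countBelow-frobenius : ∀ {c} → IsConductor S c → countBelow mem (pred c) ≡ countBelow mem c
  countBelow-frobenius {zero}  _    = refl
  countBelow-frobenius {suc f} cond = sym (begin
    countBelow mem (suc f)            ≡⟨ countBelow-suc mem f ⟩
    countBelow mem f + Bool→ℕ (mem f) ≡⟨ cong (_+_ (countBelow mem f)) (Bool→ℕ-¬T (frobenius∉S cond)) ⟩
    countBelow mem f + 0              ≡⟨ +-identityʳ _ ⟩
    countBelow mem f                  ∎)

  module _ (M : ℕ) .{{_ : NonZero M}} (M∈S : T (mem M)) where
    open Progression M

    +*M∈S : ∀ {x} k → T (mem x) → T (mem (x + k * M))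
    +*M∈S {x} zero    x∈S = subst (T ∘ mem) (sym (+-identityʳ x)) x∈S
    +*M∈S {x} (suc k) x∈S = subst (T ∘ mem) (m+n*o+o≡m+[1+n]*o x k M) (closed _ _ (+*M∈S k x∈S) M∈S)

    module _ (w : ℕ → ℕ) (ap : IsAperyListing S M w) where
      private
        w-increasing : ∀ i j → j < M → i < j → w i < w j
        w-increasing = proj₁ ap
        w-surjective : ∀ s → InApery S M s → ∃[ j ] j < M × w j ≡ s
        w-surjective = proj₁ (proj₂ ap)
        w-apery : ∀ j → j < M → InApery S M (w j)
        w-apery = proj₂ (proj₂ ap)

      decompose : ∀ s → T (mem s) → ∃[ j ] j < M × ∃[ k ] s ≡ w j + k * M
      decompose s = go s (<-wellFounded s)
        where
        apery : ∀ s → InApery S M s → ∃[ j ] j < M × ∃[ k ] s ≡ w j + k * M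
        apery s s∈Ap = let j , j<M , wj≡s = w-surjective s s∈Ap in
          j , j<M , 0 , trans (sym wj≡s) (sym (+-identityʳ (w j)))

        go : ∀ s → Acc _<_ s → T (mem s) → ∃[ j ] j < M × ∃[ k ] s ≡ w j + k * M
        go s (acc smaller) s∈S with M ≤? s
        ... | no M≰s = apery s (s∈S , λ M≤s → ⊥-elim (M≰s M≤s))
        ... | yes M≤s with T? (mem (s ∸ M))
        ...   | no s∸M∉S = apery s (s∈S , λ _ → s∸M∉S)
        ...   | yes s∸M∈S =
          let j , j<M , k , s∸M≡ = go (s ∸ M) (smaller (∸-monoʳ-< (>-nonZero⁻¹ M) M≤s)) s∸M∈S
          in j , j<M , suc k , trans (sym (m∸n+n≡m M≤s)) (trans (cong (_+ M) s∸M≡) (m+n*o+o≡m+[1+n]*o (w j) k M))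

      w-injective : ∀ {i j} → i < M → j < M → w i ≡ w j → i ≡ j
      w-injective {i} {j} i<M j<M wi≡wj with <-cmp i j
      ... | tri< i<j _ _ = ⊥-elim (<⇒≢ (w-increasing i j j<M i<j) wi≡wj)
      ... | tri≈ _ i≡j _ = i≡j
      ... | tri> _ _ j<i = ⊥-elim (<⇒≢ (w-increasing j i i<M j<i) (sym wi≡wj))

      w≢w+[1+d]*M : ∀ {i j} d → i < M → j < M → w j ≢ w i + suc d * M
      w≢w+[1+d]*M {i} {j} d i<M j<M wj≡ = proj₂ (w-apery j j<M) M≤wj wj∸M∈S
        where
        wj≡′ : w j ≡ w i + d * M + M
        wj≡′ = trans wj≡ (sym (m+n*o+o≡m+[1+n]*o (w i) d M))
        M≤wj : M ≤ w j
        M≤wj = subst (M ≤_) (sym wj≡′) (m≤n+m M _)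
        wj∸M∈S : T (mem (w j ∸ M))
        wj∸M∈S = subst (T ∘ mem) (sym (trans (cong (_∸ M) wj≡′) (m+n∸n≡m _ M)))
                       (+*M∈S d (proj₁ (w-apery i i<M)))

      residue-unique : ∀ {i j} k l → i < M → j < M → w i + k * M ≡ w j + l * M → i ≡ j
      residue-unique zero zero i<M j<M e =
        w-injective i<M j<M (trans (sym (+-identityʳ _)) (trans e (+-identityʳ _)))
      residue-unique (suc k) zero i<M j<M e =
        ⊥-elim (w≢w+[1+d]*M k i<M j<M (trans (sym (+-identityʳ _)) (sym e)))
      residue-unique zero (suc l) i<M j<M e =
        ⊥-elim (w≢w+[1+d]*M l j<M i<M (trans (sym (+-identityʳ _)) e))
      residue-unique {i} {j} (suc k) (suc l) i<M j<M e =
        residue-unique k l i<M j<M (+-cancelʳ-≡ M _ _ (begin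
          w i + k * M + M     ≡⟨ m+n*o+o≡m+[1+n]*o (w i) k M ⟩
          w i + suc k * M     ≡⟨ e ⟩
          w j + suc l * M     ≡⟨ m+n*o+o≡m+[1+n]*o (w j) l M ⟨
          w j + l * M + M     ∎))

      ∑hit≡[∈S] : ∀ N → ∑< (λ j → hit (w j) N) M ≡ Bool→ℕ (mem N)
      ∑hit≡[∈S] N with T? (mem N)
      ... | yes N∈S = let j , j<M , k , N≡ = decompose N N∈S in begin
        ∑< (λ i → hit (w i) N) M  ≡⟨ ∑<-single M j<M (λ i i<M i≢j → hit-∉ λ (l , N≡′) →
                                        i≢j (sym (residue-unique k l j<M i<M (trans (sym N≡) N≡′)))) ⟩
        hit (w j) N               ≡⟨ cong (hit (w j)) N≡ ⟩
        hit (w j) (w j + k * M)   ≡⟨ hit-∈ (w j) k ⟩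
        1                         ≡⟨ Bool→ℕ-T N∈S ⟨
        Bool→ℕ (mem N)            ∎
      ... | no N∉S = trans
        (∑<-zero M λ j j<M → hit-∉ λ (k , N≡) → N∉S (subst (T ∘ mem) (sym N≡) (+*M∈S k (proj₁ (w-apery j j<M)))))
        (sym (Bool→ℕ-¬T N∉S))

      countBelow≡∑countAP : ∀ N → countBelow mem N ≡ ∑< (λ j → countAP (w j) N) M
      countBelow≡∑countAP zero    = sym (∑<-zero M λ _ _ → refl)
      countBelow≡∑countAP (suc N) = begin
        countBelow mem (suc N)                                   ≡⟨ countBelow-suc mem N ⟩
        countBelow mem N + Bool→ℕ (mem N)                        ≡⟨ cong₂ _+_ (countBelow≡∑countAP N) (sym (∑hit≡[∈S] N)) ⟩
        ∑< (λ j → countAP (w j) N) M + ∑< (λ j → hit (w j) N) M  ≡⟨ ∑<-+ _ _ M ⟨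
        ∑< (λ j → countAP (w j) (suc N)) M                       ∎

      w0≡0 : w 0 ≡ 0
      w0≡0 with w-surjective 0 (zero∈ , λ M≤0 → ⊥-elim (<⇒≱ (>-nonZero⁻¹ M) M≤0))
      ... | zero  , _   , w0≡0 = w0≡0
      ... | suc j , j<M , wj≡0 = ⊥-elim (n≮0 (subst (w 0 <_) wj≡0 (w-increasing 0 (suc j) j<M z<s)))

      w≤w-last : ∀ j → j < M → w j ≤ w (pred M)
      w≤w-last j j<M with m≤n⇒m<n∨m≡n (<⇒≤pred j<M)
      ... | inj₁ j<pred = <⇒≤ (w-increasing j (pred M) pred<M j<pred)
      ... | inj₂ refl   = ≤-refl

      w<c+M : ∀ {c} → IsConductor S c → ∀ j → j < M → w j < c + M
      w<c+M {c} (above , _) j j<M with M ≤? w j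
      ... | no M≰wj  = ≤-trans (≰⇒> M≰wj) (m≤n+m M c)
      ... | yes M≤wj = subst (_< c + M) (m∸n+n≡m M≤wj) (+-monoˡ-< M wj∸M<c)
        where
        wj∸M<c : w j ∸ M < c
        wj∸M<c = ≰⇒> λ c≤ → proj₂ (w-apery j j<M) M≤wj (above _ c≤)

      c≤w-last : ∀ {c} → IsConductor S c → c ≤ w (pred M)
      c≤w-last {zero}  _    = z≤n
      c≤w-last {suc f} cond =
        let j , j<M , wj≡f+M = w-surjective (f + M) (f+M∈S , λ _ f∈S → frobenius∉S cond (subst (T ∘ mem) (m+n∸n≡m f M) f∈S))
        in ≤-trans (subst (suc f ≤_) (sym wj≡f+M) 1+f≤f+M) (w≤w-last j j<M)
        where
        1+f≤f+M : suc f ≤ f + M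
        1+f≤f+M = subst (_≤ f + M) (+-comm f 1) (+-monoʳ-≤ f (>-nonZero⁻¹ M))
        f+M∈S : T (mem (f + M))
        f+M∈S = proj₁ cond (f + M) 1+f≤f+M

      module _ {c q ρ} (cond : IsConductor S c) (c+ρ≡qM : c + ρ ≡ q * M) (ρ<M : ρ < M) where

        a : ℕ → ℕ
        a j = (w j + ρ) / M

        a≤q : ∀ j → j < M → a j ≤ q
        a≤q j j<M = <⇒≤pred (m<n*o⇒m/o<n
          (<-≤-trans (+-monoˡ-< ρ (w<c+M cond j j<M)) (≤-reflexive c+M+ρ≡[1+q]*M)))
          where
          c+M+ρ≡[1+q]*M : c + M + ρ ≡ suc q * M
          c+M+ρ≡[1+q]*M = begin
            c + M + ρ    ≡⟨ solve (c ∷ M ∷ ρ ∷ []) ⟩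
            c + ρ + M    ≡⟨ cong (_+ M) c+ρ≡qM ⟩
            q * M + M    ≡⟨ +-comm (q * M) M ⟩
            suc q * M    ∎

        a-last≡q : a (pred M) ≡ q
        a-last≡q = ≤-antisym (a≤q (pred M) pred<M)
          (subst (_≤ a (pred M)) (m*n/n≡m q M) (/-monoˡ-≤ M
            (subst (_≤ w (pred M) + ρ) c+ρ≡qM (+-monoˡ-≤ ρ (c≤w-last cond)))))

        a0≡0 : a 0 ≡ 0
        a0≡0 = trans (cong (λ x → (x + ρ) / M) w0≡0) (m<n⇒m/n≡0 ρ<M)

        smallElements≡∑ : smallElements S c ≡ ∑< (λ j → q ∸ a j) M
        smallElements≡∑ = begin
          countBelow mem (pred c)            ≡⟨ countBelow-frobenius cond ⟩
          countBelow mem c                   ≡⟨ countBelow≡∑countAP c ⟩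
          ∑< (λ j → countAP (w j) c) M       ≡⟨ ∑<-cong M (λ j _ → countAP-closedForm (w j) ρ (a j) ((w j + ρ) % M) c q
                                                 (m≡m%n+[m/n]*n (w j + ρ) M) (m%n<n (w j + ρ) M) c+ρ≡qM) ⟩
          ∑< (λ j → q ∸ a j) M               ∎

        +M≡1+pred : + M ≡ ℤ.1ℤ ℤ.+ + pred M
        +M≡1+pred = trans (cong +_ (sym (suc-pred M))) (ℤP.pos-+ 1 (pred M))

        Σa : ℤ
        Σa = ∑ℤ< (λ j → + a j) (pred M)

        +smallElements≡ : + smallElements S c ≡ (ℤ.1ℤ ℤ.+ + pred M) ℤ.* + q ℤ.- (Σa ℤ.+ + q)
        +smallElements≡ = begin
          + smallElements S c                      ≡⟨ cong +_ smallElements≡∑ ⟩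
          + ∑< (λ j → q ∸ a j) M                   ≡⟨ +∑<-∸ q a M a≤q ⟩
          + M ℤ.* + q ℤ.- ∑ℤ< (λ j → + a j) M      ≡⟨ cong (λ L → + L ℤ.* + q ℤ.- ∑ℤ< (λ j → + a j) L) (suc-pred M) ⟨
          + suc (pred M) ℤ.* + q ℤ.- ∑ℤ< (λ j → + a j) (suc (pred M))
            ≡⟨ cong₂ (λ m s → m ℤ.* + q ℤ.- s) (ℤP.pos-+ 1 (pred M))
                     (trans (∑ℤ<-suc _ (pred M)) (cong (λ x → Σa ℤ.+ + x) a-last≡q)) ⟩
          (ℤ.1ℤ ℤ.+ + pred M) ℤ.* + q ℤ.- (Σa ℤ.+ + q) ∎

        +c≡ : + c ≡ + q ℤ.* (ℤ.1ℤ ℤ.+ + pred M) ℤ.- + ρ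
        +c≡ = begin
          + c                                   ≡⟨ x+y-y≡x (+ c) (+ ρ) ⟨
          + c ℤ.+ + ρ ℤ.- + ρ                   ≡⟨ cong (ℤ._- + ρ) (ℤP.pos-+ c ρ) ⟨
          + (c + ρ) ℤ.- + ρ                     ≡⟨ cong (λ t → + t ℤ.- + ρ) c+ρ≡qM ⟩
          + (q * M) ℤ.- + ρ                     ≡⟨ cong (ℤ._- + ρ) (trans (ℤP.pos-* q M) (cong (ℤ._*_ (+ q)) +M≡1+pred)) ⟩
          + q ℤ.* (ℤ.1ℤ ℤ.+ + pred M) ℤ.- + ρ   ∎
          where
          x+y-y≡x : ∀ x y → x ℤ.+ y ℤ.- y ≡ x
          x+y-y≡x = ℤ-Solver.solve-∀

        wilfSum≡νn-c : ∀ ν → wilfSum M ν ρ w ≡ + (ν * smallElements S c) ℤ.- + c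
        wilfSum≡νn-c ν = begin
          wilfSum M ν ρ w
            ≡⟨ cong (ℤ._+ + ρ) (abelSummation ν M (λ j → + a j) (pred M)) ⟩
          + ν ℤ.* (+ pred M ℤ.* + a (pred M) ℤ.- Σa) ℤ.- + M ℤ.* (+ a (pred M) ℤ.- + a 0) ℤ.+ + ρ
            ≡⟨ cong₂ (λ x y → + ν ℤ.* (+ pred M ℤ.* + x ℤ.- Σa) ℤ.- + M ℤ.* (+ x ℤ.- + y) ℤ.+ + ρ) a-last≡q a0≡0 ⟩
          + ν ℤ.* (+ pred M ℤ.* + q ℤ.- Σa) ℤ.- + M ℤ.* (+ q ℤ.- + 0) ℤ.+ + ρ
            ≡⟨ cong (λ m → + ν ℤ.* (+ pred M ℤ.* + q ℤ.- Σa) ℤ.- m ℤ.* (+ q ℤ.- + 0) ℤ.+ + ρ) +M≡1+pred ⟩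
          + ν ℤ.* (+ pred M ℤ.* + q ℤ.- Σa) ℤ.- (ℤ.1ℤ ℤ.+ + pred M) ℤ.* (+ q ℤ.- + 0) ℤ.+ + ρ
            ≡⟨ regroup (+ ν) (+ pred M) (+ q) Σa (+ ρ) ⟩
          + ν ℤ.* ((ℤ.1ℤ ℤ.+ + pred M) ℤ.* + q ℤ.- (Σa ℤ.+ + q)) ℤ.- (+ q ℤ.* (ℤ.1ℤ ℤ.+ + pred M) ℤ.- + ρ)
            ≡⟨ cong₂ (λ x y → + ν ℤ.* x ℤ.- y) +smallElements≡ +c≡ ⟨
          + ν ℤ.* + smallElements S c ℤ.- + c
            ≡⟨ cong (ℤ._- + c) (ℤP.pos-* ν (smallElements S c)) ⟨
          + (ν * smallElements S c) ℤ.- + c ∎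
          where
          regroup : ∀ ν L q A ρ →
            ν ℤ.* (L ℤ.* q ℤ.- A) ℤ.- (ℤ.1ℤ ℤ.+ L) ℤ.* (q ℤ.- + 0) ℤ.+ ρ
              ≡ ν ℤ.* ((ℤ.1ℤ ℤ.+ L) ℤ.* q ℤ.- (A ℤ.+ q)) ℤ.- (q ℤ.* (ℤ.1ℤ ℤ.+ L) ℤ.- ρ)
          regroup = ℤ-Solver.solve-∀

proposition3 : (S : NumericalSemigroup) (m ν c q ρ : ℕ) .{{_ : NonZero m}} (w : ℕ → ℕ)
    → IsMultiplicity S m → IsEmbeddingDimension S ν → IsConductor S c
    → c + ρ ≡ q * m → ρ < m
    → IsAperyListing S m w
    → (c ≤ ν * smallElements S c) ⇔ (+ 0 ≤ℤ wilfSum m ν ρ w)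
proposition3 S m ν c q ρ w (_ , m∈S , _) _ cond c+ρ≡qm ρ<m ap =
  subst (λ z → (c ≤ ν * smallElements S c) ⇔ (+ 0 ≤ℤ z))
        (sym (Apery.wilfSum≡νn-c S m m∈S w ap {q = q} cond c+ρ≡qm ρ<m ν))
        ≤⇔0≤[+n]-[+m]
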